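{- Let $n$ be a positive integer and let $G=\langle B,\rho\tau_0^{\epsilon},\sigma\tau_0^{\epsilon}\tau_J\rangle\le\mathrm{Aut}(\mathrm{C}_n^{(2)})$, where $B\le K$ is nontrivial and normal in $G$, $\epsilon\in\{0,1\}$ with $\tau_{\mathbb{Z}_n}^{\epsilon}\in B$, and $J\subseteq\mathbb{Z}_n$ with $\tau_J\tau_{ -J}\in B$ and $\tau_J\tau_{J+1}\in B$. Suppose $B$ has exact period $k\ge1$ and that $B$ equals the largest subgroup of $K$ with exact period $k$, namely $\langle\tau_{[0,k]},\tau_{[1,k]},\dots,\tau_{[k-1,k]}\rangle$. Then $G=\langle B,\rho\tau_0^{\epsilon},\sigma\tau_0^{\epsilon}\tau_L\rangle$, where either $\tau_L=\tau_{\mathbb{Z}_n}$, or $2k$ divides $n$ and $\tau_L=\prod_{i=0}^{k-1}\tau_{[i,2k]}$.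
   Context: $\mathrm{C}_n^{(2)}$ is the doubled cycle: vertex set $\mathbb{Z}_n$, and for each $i\in\mathbb{Z}_n$ two darts $a_i,b_i$ from $i$ to $i+1$ with inverse darts $a_i^{ -1},b_i^{ -1}$. Automorphisms compose left to right ($x^{\alpha\beta}=(x^\alpha)^\beta$). $\tau_j$ swaps $a_j\leftrightarrow b_j$ (and inverses) fixing everything else; $\tau_J=\prod_{j\in J}\tau_j$; $\rho\colon a_i\mapsto a_{i+1},b_i\mapsto b_{i+1}$; $\sigma\colon a_i\mapsto a_{ -i}^{ -1},b_i\mapsto b_{ -i}^{ -1}$. $K=\{\tau_J:J\subseteq\mathbb{Z}_n\}$. $J+k=\{j+k:j\in J\}$, $-J=\{ -j:j\in J\}$. An integer $k$ with $1\le k\le n$ is a period of a subgroup $H\le K$ if $\tau_{L+k}=\tau_L$ for all $\tau_L\in H$ (equivalently $H$ is centralized by $\rho^k$); the exact period of $H$ is its smallest positive period (it divides $n$). For a divisor $k$ of $n$, $\tau_{[i,k]}=\tau_i\tau_{i+k}\tau_{i+2k}\cdots\tau_{i+(n/k-1)k}$. -}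

module Defs where

open import Data.Nat using (ℕ; zero; suc; _+_; _*_; _∸_; _≤_; _<_; NonZero)
open import Data.Nat.DivMod using (_mod_; _/_)
open import Data.Nat.Properties using (m*n≢0)
open import Data.Fin using (Fin; toℕ; _≟_)
open import Data.Bool using (Bool; true; false; not; _xor_; if_then_else_)
open import Data.Product using (Σ; _×_; _,_)
open import Data.Sum using (_⊎_)
open import Data.List using (List; foldr; upTo)
open import Relation.Binary.PropositionalEquality using (_≡_)
open import Relation.Nullary.Decidable using (⌊_⌋)

module _ {n : ℕ} .{{_ : NonZero n}} where

  [_]ₙ : ℕ → Fin n
  [ a ]ₙ = a mod n

  _+ₙ_ : Fin n → ℕ → Fin n
  i +ₙ a = (toℕ i + a) mod n

  _-ₙ_ : Fin n → ℕ → Fin n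
  i -ₙ a = (toℕ i + (n ∸ toℕ ([ a ]ₙ))) mod n

  negₙ : Fin n → Fin n
  negₙ i = (n ∸ toℕ i) mod n

-- Darts of the doubled cycle C_n^(2).
-- (i , false , false) = a_i,  (i , true , false) = b_i,
-- (i , false , true ) = a_i⁻¹, (i , true , true ) = b_i⁻¹.

Dart : ℕ → Set
Dart n = Fin n × Bool × Bool

Aut : ℕ → Set
Aut n = Dart n → Dart n

_≈_ : ∀ {n} → Aut n → Aut n → Set
f ≈ g = ∀ x → f x ≡ g x

idA : ∀ {n} → Aut n
idA x = x

-- left-to-right composition: x^(f·g) = (x^f)^g
_·_ : ∀ {n} → Aut n → Aut n → Aut n
(f · g) x = g (f x)

infixl 7 _·_

SubsetZ : ℕ → Set
SubsetZ n = Fin n → Bool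

fullZ : ∀ {n} → SubsetZ n
fullZ _ = true

module _ {n : ℕ} .{{_ : NonZero n}} where

  shiftZ : SubsetZ n → ℕ → SubsetZ n
  shiftZ J k x = J (x -ₙ k)

  negZ : SubsetZ n → SubsetZ n
  negZ J x = J (negₙ x)

τ : ∀ {n} → SubsetZ n → Aut n
τ J (i , l , inv) = (i , l xor J i , inv)

τ₁ : ∀ {n} → Fin n → Aut n
τ₁ j = τ (λ x → ⌊ x ≟ j ⌋)

module _ {n : ℕ} .{{_ : NonZero n}} where

  ρ : Aut n
  ρ (i , l , inv) = (i +ₙ 1 , l , inv)

  σ : Aut n
  σ (i , l , inv) = (negₙ i , l , not inv)

  τ₀^ : Bool → Aut n
  τ₀^ ε = if ε then τ₁ [ 0 ]ₙ else idA

  τfull^ : Bool → Aut n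
  τfull^ ε = if ε then τ fullZ else idA

  τcls : (i k : ℕ) .{{_ : NonZero k}} → Aut n
  τcls i k = foldr (λ t acc → τ₁ [ i + t * k ]ₙ · acc) idA (upTo (n / k))

  prodCls : (c k : ℕ) .{{_ : NonZero k}} → Aut n
  prodCls c k = foldr (λ i acc → τcls i k · acc) idA (upTo c)

  prodCls2k : (k : ℕ) .{{_ : NonZero k}} → Aut n
  prodCls2k k = prodCls k (2 * k) {{m*n≢0 2 k}}

-- Subgroup generated by a set S of automorphisms (closure under
-- identity, composition and extensional equality; for permutations of a
-- finite set this is the generated subgroup).

data Gen {n : ℕ} (S : Aut n → Set) : Aut n → Set where
  gen : ∀ {f} → S f → Gen S f
  one : Gen S idA
  mul : ∀ {f g} → Gen S f → Gen S g → Gen S (f · g)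
  ext : ∀ {f g} → f ≈ g → Gen S f → Gen S g

_≐_ : ∀ {n} → (Aut n → Set) → (Aut n → Set) → Set
H ≐ H' = ∀ f → (H f → H' f) × (H' f → H f)

module _ {n : ℕ} .{{_ : NonZero n}} where

  IsPeriod : (Aut n → Set) → ℕ → Set
  IsPeriod H k = (1 ≤ k) × (k ≤ n) × (∀ L → H (τ L) → τ (shiftZ L k) ≈ τ L)

  ExactPeriod : (Aut n → Set) → ℕ → Set
  ExactPeriod H k = IsPeriod H k × (∀ k' → IsPeriod H k' → k ≤ k')

  GenSet : (B : Aut n → Set) → Bool → SubsetZ n → Aut n → Set
  GenSet B ε L f = B f ⊎ (f ≈ (ρ · τ₀^ ε)) ⊎ (f ≈ (σ · τ₀^ ε · τ L))

  ClsGens : (k : ℕ) .{{_ : NonZero k}} → Aut n → Set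
  ClsGens k f = Σ ℕ (λ i → (i < k) × (f ≈ τcls i k))

module Submission where

-- The elements of B are exactly the τ_S with S k-periodic: k ∣ n, since otherwise n mod k would
-- be a smaller period, and then τ_S is the product of the τ_[i,k] over i < k with i ∈ S.
-- As στ₀^ε τ_J = (στ₀^ε τ_L)(τ_L τ_J), the set J may be replaced by any L with τ_L τ_J ∈ B.
-- Because τ_J τ_{J+1} ∈ B, the set J Δ (J+1) is k-periodic, so J(m) ⊕ J(m+k) does not depend
-- on m. Either J is k-periodic and L = ℤ_n works, or J(m+k) = ¬ J(m); then n/k is even as
-- J(n) = J(0), and L = {x : x mod 2k < k}, which flips in the same way and has
-- τ_L = ∏_{i<k} τ_[i,2k], works.

open import Defs
open import Data.Nat using (ℕ; zero; suc; _+_; _*_; _∸_; _<_; NonZero; _%_; _/_; _≟_; _<?_; z<s; s<s; >-nonZero⁻¹)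
open import Data.Nat.Properties
open import Data.Nat.DivMod
open import Data.Nat.Divisibility using (_∣_; divides; m%n≡0⇒n∣m; ∣m∣n⇒∣m+n; ∣-refl; *-pres-∣)
open import Data.Fin using (Fin; toℕ)
import Data.Fin as Fin
open import Data.Fin.Properties using (toℕ-fromℕ<; toℕ-injective; toℕ<n)
open import Data.Bool using (Bool; true; false; not; _xor_; _∧_)
open import Data.Bool.Properties
  using ( xor-assoc; xor-comm; xor-same; xor-identityʳ; xor-annihilates-not; not-distribʳ-xor
        ; not-involutive; not-¬; ∧-identityʳ; ∧-zeroʳ)
open import Data.List using (List; []; _∷_; foldr; upTo; applyUpTo)
open import Data.List.Relation.Unary.All using (All; []; _∷_)
open import Data.List.Relation.Unary.All.Properties using (applyUpTo⁺₁)
open import Data.Empty using (⊥-elim)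
open import Data.Product using (Σ; _×_; _,_; proj₁; proj₂)
open import Data.Sum using (_⊎_; inj₁; inj₂; [_,_]′)
open import Function using (id; _∘_)
open import Relation.Nullary using (¬_; yes; no)
open import Relation.Nullary.Decidable using (Dec; ⌊_⌋; dec-true; dec-false; isYes≗does)
open import Relation.Binary.PropositionalEquality

xor-transpose : ∀ w x y z → w xor x ≡ y xor z → y xor w ≡ z xor x
xor-transpose false false false false e = refl
xor-transpose false false true  true  e = refl
xor-transpose false true  false true  e = refl
xor-transpose false true  true  false e = refl
xor-transpose true  false false true  e = refl
xor-transpose true  false true  false e = refl
xor-transpose true  true  false false e = refl
xor-transpose true  true  true  true  e = refl
xor-transpose false false false true  ()
xor-transpose false false true  false ()
xor-transpose false true  false false ()
xor-transpose false true  true  true  ()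
xor-transpose true  false false false ()
xor-transpose true  false true  true  ()
xor-transpose true  true  false true  ()
xor-transpose true  true  true  false ()

xor-≡⇒≡xor : ∀ x {y c} → x xor y ≡ c → y ≡ x xor c
xor-≡⇒≡xor x {y} refl = sym (trans (sym (xor-assoc x x y)) (cong (_xor y) (xor-same x)))

⌊⌋-true : ∀ {a} {A : Set a} (a? : Dec A) → A → ⌊ a? ⌋ ≡ true
⌊⌋-true a? a = trans (isYes≗does a?) (dec-true a? a)

⌊⌋-false : ∀ {a} {A : Set a} (a? : Dec A) → ¬ A → ⌊ a? ⌋ ≡ false
⌊⌋-false a? ¬a = trans (isYes≗does a?) (dec-false a? ¬a)

xorSum : (ℕ → Bool) → List ℕ → Bool
xorSum h = foldr (λ t b → h t xor b) false

xorSum-≡false : ∀ {h : ℕ → Bool} {xs} → All (λ t → h t ≡ false) xs → xorSum h xs ≡ false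
xorSum-≡false [] = refl
xorSum-≡false (ht≡false ∷ rest) rewrite ht≡false = xorSum-≡false rest

xorSum-applyUpTo-single : ∀ (h : ℕ → Bool) f {q s} → s < q → (∀ t → t < q → t ≢ s → h (f t) ≡ false) →
                          xorSum h (applyUpTo f q) ≡ h (f s)
xorSum-applyUpTo-single h f {suc q} {zero} _ others =
  trans (cong (h (f 0) xor_) (xorSum-≡false {h} (applyUpTo⁺₁ (f ∘ suc) q λ t<q → others _ (s<s t<q) λ ())))
        (xor-identityʳ (h (f 0)))
xorSum-applyUpTo-single h f {suc q} {suc s} (s<s s<q) others
  rewrite others 0 z<s (λ ())
  = xorSum-applyUpTo-single h (f ∘ suc) s<q λ t t<q t≢s → others (suc t) (s<s t<q) (t≢s ∘ suc-injective)

_⊕_ : ∀ {n} → SubsetZ n → SubsetZ n → SubsetZ n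
(S ⊕ T) x = S x xor T x

module _ {n : ℕ} where

  τ-cong : ∀ {A C : SubsetZ n} → A ≗ C → τ A ≈ τ C
  τ-cong A≗C (i , l , inv) = cong (λ b → i , l xor b , inv) (A≗C i)

  τ-injective : ∀ {A C : SubsetZ n} → τ A ≈ τ C → A ≗ C
  τ-injective τA≈τC x = cong (λ d → proj₁ (proj₂ d)) (τA≈τC (x , false , false))

  τ-· : ∀ (A C : SubsetZ n) → (τ A · τ C) ≈ τ (A ⊕ C)
  τ-· A C (i , l , inv) = cong (λ b → i , b , inv) (xor-assoc l (A i) (C i))

  τ-∅ : idA ≈ τ {n} (λ _ → false)
  τ-∅ (i , l , inv) = cong (λ b → i , b , inv) (sym (xor-identityʳ l))

  foldr-·-τ : ∀ {g : ℕ → Aut n} {F : ℕ → SubsetZ n} xs → All (λ t → g t ≈ τ (F t)) xs →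
              foldr (λ t acc → g t · acc) idA xs ≈ τ (λ x → xorSum (λ t → F t x) xs)
  foldr-·-τ [] [] = τ-∅
  foldr-·-τ {g} {F} (t ∷ xs) (gt≈τFt ∷ rest) y =
    trans (cong (foldr (λ t acc → g t · acc) idA xs) (gt≈τFt y))
          (trans (foldr-·-τ xs rest (τ (F t) y)) (τ-· (F t) (λ x → xorSum (λ t → F t x) xs) y))

  Gen-τ-xorSum : ∀ {G : Aut n → Set} {F : ℕ → SubsetZ n} xs → All (λ t → Gen G (τ (F t))) xs →
                 Gen G (τ (λ x → xorSum (λ t → F t x) xs))
  Gen-τ-xorSum [] [] = ext τ-∅ one
  Gen-τ-xorSum {F = F} (t ∷ xs) (gen-t ∷ rest) =
    ext (τ-· (F t) (λ x → xorSum (λ t → F t x) xs)) (mul gen-t (Gen-τ-xorSum xs rest))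

module _ {n : ℕ} .{{_ : NonZero n}} where

  toℕ-[]ₙ : ∀ m → toℕ {n} [ m ]ₙ ≡ m % n
  toℕ-[]ₙ m = toℕ-fromℕ< (m%n<n m n)

  []ₙ-toℕ : (x : Fin n) → [ toℕ x ]ₙ ≡ x
  []ₙ-toℕ x = toℕ-injective (trans (toℕ-[]ₙ (toℕ x)) (m<n⇒m%n≡m (toℕ<n x)))

  %≡⇒[]ₙ≡ : ∀ {a b} → a % n ≡ b % n → [_]ₙ {n} a ≡ [ b ]ₙ
  %≡⇒[]ₙ≡ {a} {b} eq = toℕ-injective (trans (toℕ-[]ₙ a) (trans eq (sym (toℕ-[]ₙ b))))

  n∣[n∸[a]]+a : ∀ a → n ∣ (n ∸ toℕ {n} [ a ]ₙ) + a
  n∣[n∸[a]]+a a = divides (suc (a / n)) (begin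
      (n ∸ toℕ {n} [ a ]ₙ) + a        ≡⟨ cong (λ r → (n ∸ r) + a) (toℕ-[]ₙ a) ⟩
      (n ∸ a % n) + a                 ≡⟨ cong ((n ∸ a % n) +_) (m≡m%n+[m/n]*n a n) ⟩
      (n ∸ a % n) + (a % n + a / n * n) ≡⟨ +-assoc (n ∸ a % n) (a % n) _ ⟨
      (n ∸ a % n) + a % n + a / n * n ≡⟨ cong (_+ a / n * n) (m∸n+n≡m (m%n≤n a n)) ⟩
      n + a / n * n                   ∎)
    where open ≡-Reasoning

  [m+a]-ₙa≡[m] : ∀ m a → [ m + a ]ₙ -ₙ a ≡ [ m ]ₙ
  [m+a]-ₙa≡[m] m a = %≡⇒[]ₙ≡ (begin
      (toℕ {n} [ m + a ]ₙ + c) % n ≡⟨ cong (λ r → (r + c) % n) (toℕ-[]ₙ (m + a)) ⟩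
      ((m + a) % n + c) % n       ≡⟨ %-distribˡ-+ ((m + a) % n) c n ⟩
      ((m + a) % n % n + c % n) % n ≡⟨ cong (λ r → (r + c % n) % n) (m%n%n≡m%n (m + a) n) ⟩
      ((m + a) % n + c % n) % n   ≡⟨ %-distribˡ-+ (m + a) c n ⟨
      (m + a + c) % n             ≡⟨ cong (_% n) (trans (+-assoc m a c) (cong (m +_) (+-comm a c))) ⟩
      (m + (c + a)) % n           ≡⟨ %-remove-+ʳ m (n∣[n∸[a]]+a a) ⟩
      m % n                       ∎)
    where
      c = n ∸ toℕ {n} [ a ]ₙ
      open ≡-Reasoning

  [x-ₙa+a]≡x : ∀ (x : Fin n) a → [ toℕ x + (n ∸ toℕ {n} [ a ]ₙ) + a ]ₙ ≡ x
  [x-ₙa+a]≡x x a = trans (%≡⇒[]ₙ≡ (trans (cong (_% n) (+-assoc (toℕ x) _ a))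
                                          (%-remove-+ʳ (toℕ x) (n∣[n∸[a]]+a a))))
                         ([]ₙ-toℕ x)

  Periodic : SubsetZ n → ℕ → Set
  Periodic S a = ∀ m → S [ m + a ]ₙ ≡ S [ m ]ₙ

  Antiperiodic : SubsetZ n → ℕ → Set
  Antiperiodic S a = ∀ m → S [ m + a ]ₙ ≡ not (S [ m ]ₙ)

  shiftZ≗⇒periodic : ∀ {S a} → shiftZ S a ≗ S → Periodic S a
  shiftZ≗⇒periodic {S} {a} h m = trans (sym (h [ m + a ]ₙ)) (cong S ([m+a]-ₙa≡[m] m a))

  periodic⇒shiftZ≗ : ∀ {S a} → Periodic S a → shiftZ S a ≗ S
  periodic⇒shiftZ≗ {S} {a} p x = trans (sym (p (toℕ x + (n ∸ toℕ {n} [ a ]ₙ)))) (cong S ([x-ₙa+a]≡x x a))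

  periodic-n : ∀ S → Periodic S n
  periodic-n S m = cong S (%≡⇒[]ₙ≡ ([m+n]%n≡m%n m n))

  periodic-* : ∀ {S a} → Periodic S a → ∀ t → Periodic S (t * a)
  periodic-* {S} p zero m = cong (λ r → S [ r ]ₙ) (+-identityʳ m)
  periodic-* {S} {a} p (suc t) m = begin
      S [ m + (a + t * a) ]ₙ ≡⟨ cong (λ r → S [ r ]ₙ) (trans (cong (m +_) (+-comm a (t * a))) (sym (+-assoc m (t * a) a))) ⟩
      S [ m + t * a + a ]ₙ   ≡⟨ p (m + t * a) ⟩
      S [ m + t * a ]ₙ       ≡⟨ periodic-* {S} {a} p t m ⟩
      S [ m ]ₙ               ∎
    where open ≡-Reasoning

  periodic-reduce : ∀ {S a} .{{_ : NonZero a}} → Periodic S a → ∀ m → S [ m ]ₙ ≡ S [ m % a ]ₙ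
  periodic-reduce {S} {a} p m =
    trans (cong (λ r → S [ r ]ₙ) (m≡m%n+[m/n]*n m a)) (periodic-* {S} {a} p (m / a) (m % a))

  periodic-% : ∀ {S a} .{{_ : NonZero a}} → Periodic S a → Periodic S (n % a)
  periodic-% {S} {a} p m = begin
      S [ m + n % a ]ₙ             ≡⟨ periodic-* {S} {a} p (n / a) (m + n % a) ⟨
      S [ m + n % a + n / a * a ]ₙ ≡⟨ cong (λ r → S [ r ]ₙ) (trans (+-assoc m _ _) (cong (m +_) (sym (m≡m%n+[m/n]*n n a)))) ⟩
      S [ m + n ]ₙ                 ≡⟨ periodic-n S m ⟩
      S [ m ]ₙ                     ∎
    where open ≡-Reasoning

  ⊕-periodic : ∀ {S T a} → Periodic S a → Periodic T a → Periodic (S ⊕ T) a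
  ⊕-periodic p q m = cong₂ _xor_ (p m) (q m)

  ⊕-antiperiodic : ∀ {S T a} → Antiperiodic S a → Antiperiodic T a → Periodic (S ⊕ T) a
  ⊕-antiperiodic {S} {T} p q m = trans (cong₂ _xor_ (p m) (q m)) (xor-annihilates-not (S [ m ]ₙ) (T [ m ]ₙ))

  antiperiodic-suc-* : ∀ {S a} → Antiperiodic S a → ∀ q → S [ suc q * a ]ₙ ≡ not (S [ q * a ]ₙ)
  antiperiodic-suc-* {S} {a} p q = trans (cong (λ r → S [ r ]ₙ) (+-comm a (q * a))) (p (q * a))

  antiperiodic⇒even : ∀ {S a} → Antiperiodic S a → ∀ q → S [ q * a ]ₙ ≡ S [ 0 ]ₙ → 2 ∣ q
  antiperiodic⇒even p zero _ = divides 0 refl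
  antiperiodic⇒even {S} {a} p (suc zero) e =
    ⊥-elim (not-¬ refl (sym (trans (sym (antiperiodic-suc-* {S} {a} p 0)) e)))
  antiperiodic⇒even {S} {a} p (suc (suc q)) e =
    ∣m∣n⇒∣m+n {m = 2} ∣-refl (antiperiodic⇒even {S} {a} p q (begin
      S [ q * a ]ₙ             ≡⟨ not-involutive _ ⟨
      not (not (S [ q * a ]ₙ)) ≡⟨ cong not (antiperiodic-suc-* {S} {a} p q) ⟨
      not (S [ suc q * a ]ₙ)   ≡⟨ antiperiodic-suc-* {S} {a} p (suc q) ⟨
      S [ suc (suc q) * a ]ₙ   ≡⟨ e ⟩
      S [ 0 ]ₙ                 ∎))
    where open ≡-Reasoning

  antiperiodic⇒2*∣n : ∀ {S a} .{{_ : NonZero a}} → a ∣ n → Antiperiodic S a → 2 * a ∣ n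
  antiperiodic⇒2*∣n {S} {a} a∣n p =
    subst (2 * a ∣_) (m/n*n≡m a∣n) (*-pres-∣ (antiperiodic⇒even {S} {a} p (n / a) wraps) (∣-refl {a}))
    where
      wraps : S [ n / a * a ]ₙ ≡ S [ 0 ]ₙ
      wraps = trans (cong (λ r → S [ r ]ₙ) (m/n*n≡m a∣n)) (periodic-n S 0)

  periodic-or-antiperiodic : ∀ {S a} → Periodic (S ⊕ shiftZ S 1) a → Periodic S a ⊎ Antiperiodic S a
  periodic-or-antiperiodic {S} {a} p =
    classify (S [ 0 ]ₙ xor S [ a ]ₙ) (λ m → xor-≡⇒≡xor (S [ m ]ₙ) (difference-constant m))
    where
      step-difference : ∀ m → (S ⊕ shiftZ S 1) [ suc m ]ₙ ≡ S [ suc m ]ₙ xor S [ m ]ₙ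
      step-difference m = cong (λ x → S [ suc m ]ₙ xor S x)
                               (trans (cong (λ r → [ r ]ₙ -ₙ 1) (+-comm 1 m)) ([m+a]-ₙa≡[m] m 1))
      difference-constant : ∀ m → S [ m ]ₙ xor S [ m + a ]ₙ ≡ S [ 0 ]ₙ xor S [ a ]ₙ
      difference-constant zero = refl
      difference-constant (suc m) = trans
        (xor-transpose (S [ suc (m + a) ]ₙ) (S [ m + a ]ₙ) (S [ suc m ]ₙ) (S [ m ]ₙ)
          (trans (sym (step-difference (m + a))) (trans (p (suc m)) (step-difference m))))
        (difference-constant m)
      classify : ∀ c → (∀ m → S [ m + a ]ₙ ≡ S [ m ]ₙ xor c) → Periodic S a ⊎ Antiperiodic S a
      classify false h = inj₁ λ m → trans (h m) (xor-identityʳ (S [ m ]ₙ))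
      classify true h = inj₂ λ m →
        trans (h m) (trans (sym (not-distribʳ-xor (S [ m ]ₙ) false)) (cong not (xor-identityʳ (S [ m ]ₙ))))

module _ {n : ℕ} .{{_ : NonZero n}} (k : ℕ) .{{_ : NonZero k}} where

  residueClass : ℕ → SubsetZ n
  residueClass i x = ⌊ toℕ x % k ≟ i ⌋

  τcls≈τ-residueClass : k ∣ n → ∀ {i} → i < k → τcls i k ≈ τ (residueClass i)
  τcls≈τ-residueClass k∣n {i} i<k y =
    trans (foldr-·-τ (upTo (n / k)) (applyUpTo⁺₁ id (n / k) λ _ _ → refl) y) (τ-cong sum≡class y)
    where
      toℕ-[i+tk] : ∀ {t} → t < n / k → toℕ {n} [ i + t * k ]ₙ ≡ i + t * k
      toℕ-[i+tk] {t} t<n/k = trans (toℕ-[]ₙ (i + t * k)) (m<n⇒m%n≡m (begin-strict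
          i + t * k   <⟨ +-monoˡ-< (t * k) i<k ⟩
          k + t * k   ≤⟨ *-monoˡ-≤ k t<n/k ⟩
          n / k * k   ≡⟨ m/n*n≡m k∣n ⟩
          n           ∎))
        where open ≤-Reasoning
      sum≡class : ∀ x → xorSum (λ t → ⌊ x Fin.≟ [ i + t * k ]ₙ ⌋) (upTo (n / k)) ≡ residueClass i x
      sum≡class x with toℕ x % k ≟ i
      ... | yes x%k≡i = trans (xorSum-applyUpTo-single _ id x/k<n/k others)
                              (⌊⌋-true (x Fin.≟ _) (toℕ-injective (trans x≡ (sym (toℕ-[i+tk] x/k<n/k)))))
        where
          x≡ : toℕ x ≡ i + toℕ x / k * k
          x≡ = trans (m≡m%n+[m/n]*n (toℕ x) k) (cong (_+ toℕ x / k * k) x%k≡i)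
          x/k<n/k : toℕ x / k < n / k
          x/k<n/k = m<n*o⇒m/o<n (subst (toℕ x <_) (sym (m/n*n≡m k∣n)) (toℕ<n x))
          others : ∀ t → t < n / k → t ≢ toℕ x / k → ⌊ x Fin.≟ [ i + t * k ]ₙ ⌋ ≡ false
          others t t<n/k t≢ = ⌊⌋-false (x Fin.≟ _) λ x≡[i+tk] → t≢ (*-cancelʳ-≡ t _ k (+-cancelˡ-≡ i _ _
            (trans (sym (toℕ-[i+tk] t<n/k)) (trans (cong toℕ (sym x≡[i+tk])) x≡))))
      ... | no x%k≢i = xorSum-≡false (applyUpTo⁺₁ id (n / k) λ {t} t<n/k → ⌊⌋-false (x Fin.≟ _) λ x≡[i+tk] →
              x%k≢i (begin
                toℕ x % k           ≡⟨ cong (λ y → toℕ y % k) x≡[i+tk] ⟩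
                toℕ {n} [ i + t * k ]ₙ % k ≡⟨ cong (_% k) (toℕ-[i+tk] t<n/k) ⟩
                (i + t * k) % k     ≡⟨ [m+kn]%n≡m%n i t k ⟩
                i % k               ≡⟨ m<n⇒m%n≡m i<k ⟩
                i                   ∎))
        where open ≡-Reasoning

  periodic⇒Gen-ClsGens : k ∣ n → ∀ {S : SubsetZ n} → Periodic S k → Gen (ClsGens k) (τ S)
  periodic⇒Gen-ClsGens k∣n {S} p =
    ext (τ-cong sum≡S) (Gen-τ-xorSum (upTo k) (applyUpTo⁺₁ id k classInGen))
    where
      classInGen : ∀ {i} → i < k → Gen (ClsGens k) (τ (λ x → S [ i ]ₙ ∧ residueClass i x))
      classInGen {i} i<k with S [ i ]ₙ
      ... | true  = ext (τcls≈τ-residueClass k∣n i<k) (gen (i , i<k , λ _ → refl))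
      ... | false = ext τ-∅ one
      sum≡S : ∀ (x : Fin n) → xorSum (λ i → S [ i ]ₙ ∧ residueClass i x) (upTo k) ≡ S x
      sum≡S x = begin
        xorSum (λ i → S [ i ]ₙ ∧ residueClass i x) (upTo k)
          ≡⟨ xorSum-applyUpTo-single _ id (m%n<n (toℕ x) k) (λ t _ t≢ →
               trans (cong (S [ t ]ₙ ∧_) (⌊⌋-false (toℕ x % k ≟ t) (t≢ ∘ sym))) (∧-zeroʳ (S [ t ]ₙ))) ⟩
        S [ toℕ x % k ]ₙ ∧ residueClass (toℕ x % k) x
          ≡⟨ cong (S [ toℕ x % k ]ₙ ∧_) (⌊⌋-true (toℕ x % k ≟ _) refl) ⟩
        S [ toℕ x % k ]ₙ ∧ true ≡⟨ ∧-identityʳ _ ⟩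
        S [ toℕ x % k ]ₙ       ≡⟨ periodic-reduce {S = S} p (toℕ x) ⟨
        S [ toℕ x ]ₙ           ≡⟨ cong S ([]ₙ-toℕ x) ⟩
        S x                    ∎
        where open ≡-Reasoning

module _ {n : ℕ} .{{_ : NonZero n}} (k : ℕ) .{{_ : NonZero k}} where
  private instance
    2k≢0 : NonZero (2 * k)
    2k≢0 = m*n≢0 2 k

  halfClass : SubsetZ n
  halfClass x = ⌊ toℕ x % (2 * k) <? k ⌋

  private
    2k≡k+k : 2 * k ≡ k + k
    2k≡k+k = cong (k +_) (+-identityʳ k)

    k<2k : k < 2 * k
    k<2k = subst (k <_) (sym 2k≡k+k) (m<m+n k (>-nonZero⁻¹ k))

  prodCls2k≈τ-halfClass : 2 * k ∣ n → prodCls2k k ≈ τ halfClass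
  prodCls2k≈τ-halfClass 2k∣n y =
    trans (foldr-·-τ (upTo k) (applyUpTo⁺₁ id k λ t<k → τcls≈τ-residueClass (2 * k) 2k∣n (<-trans t<k k<2k)) y)
          (τ-cong sum≡half y)
    where
      sum≡half : ∀ (x : Fin n) → xorSum (λ t → residueClass (2 * k) t x) (upTo k) ≡ halfClass x
      sum≡half x with toℕ x % (2 * k) <? k
      ... | yes r<k = trans (xorSum-applyUpTo-single _ id r<k λ t _ t≢r → ⌊⌋-false (_ ≟ t) (t≢r ∘ sym))
                            (⌊⌋-true (_ ≟ _) refl)
      ... | no r≮k = xorSum-≡false (applyUpTo⁺₁ id k λ {t} t<k →
                       ⌊⌋-false (_ ≟ t) λ r≡t → r≮k (subst (_< k) (sym r≡t) t<k))

  halfClass-antiperiodic : 2 * k ∣ n → Antiperiodic halfClass k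
  halfClass-antiperiodic 2k∣n m = begin
      ⌊ toℕ {n} [ m + k ]ₙ % (2 * k) <? k ⌋         ≡⟨ cong (λ r → ⌊ r <? k ⌋) (toℕ-[]ₙ-% (m + k)) ⟩
      ⌊ (m + k) % (2 * k) <? k ⌋                   ≡⟨ cong (λ r → ⌊ r <? k ⌋) (%-distribˡ-+ m k (2 * k)) ⟩
      ⌊ (m % (2 * k) + k % (2 * k)) % (2 * k) <? k ⌋ ≡⟨ cong (λ r → ⌊ (m % (2 * k) + r) % (2 * k) <? k ⌋) (m<n⇒m%n≡m k<2k) ⟩
      ⌊ (m % (2 * k) + k) % (2 * k) <? k ⌋          ≡⟨ shift-flips (m % (2 * k)) (m%n<n m (2 * k)) ⟩
      not ⌊ m % (2 * k) <? k ⌋                      ≡⟨ cong (λ r → not ⌊ r <? k ⌋) (toℕ-[]ₙ-% m) ⟨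
      not ⌊ toℕ {n} [ m ]ₙ % (2 * k) <? k ⌋         ∎
    where
      open ≡-Reasoning
      toℕ-[]ₙ-% : ∀ m → toℕ {n} [ m ]ₙ % (2 * k) ≡ m % (2 * k)
      toℕ-[]ₙ-% m = trans (cong (_% (2 * k)) (toℕ-[]ₙ m)) (m∣n⇒o%n%m≡o%m (2 * k) n m 2k∣n)
      shift-flips : ∀ r → r < 2 * k → ⌊ (r + k) % (2 * k) <? k ⌋ ≡ not ⌊ r <? k ⌋
      shift-flips r r<2k with r <? k
      ... | yes r<k = ⌊⌋-false (_ <? k) λ lt → m+n≮n r k (subst (_< k) (m<n⇒m%n≡m r+k<2k) lt)
        where
          r+k<2k : r + k < 2 * k
          r+k<2k = subst (r + k <_) (sym 2k≡k+k) (+-monoˡ-< k r<k)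
      ... | no r≮k = ⌊⌋-true (_ <? k) (subst (_< k) (sym %-wraps) r∸k<k)
        where
          k≤r = ≮⇒≥ r≮k
          r∸k<k : r ∸ k < k
          r∸k<k = m<n+o⇒m∸n<o r k (subst (r <_) 2k≡k+k r<2k)
          %-wraps : (r + k) % (2 * k) ≡ r ∸ k
          %-wraps = begin
            (r + k) % (2 * k)           ≡⟨ cong (λ s → (s + k) % (2 * k)) (m∸n+n≡m k≤r) ⟨
            (r ∸ k + k + k) % (2 * k)   ≡⟨ cong (_% (2 * k)) (trans (+-assoc (r ∸ k) k k) (cong (r ∸ k +_) (sym 2k≡k+k))) ⟩
            (r ∸ k + 2 * k) % (2 * k)   ≡⟨ [m+n]%n≡m%n (r ∸ k) (2 * k) ⟩
            (r ∸ k) % (2 * k)           ≡⟨ m<n⇒m%n≡m (<-trans r∸k<k k<2k) ⟩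
            r ∸ k                       ∎

module _ {n : ℕ} .{{_ : NonZero n}} where

  isPeriod⇒periodic : ∀ {H k} → IsPeriod H k → ∀ {L} → H (τ L) → Periodic L k
  isPeriod⇒periodic (_ , _ , τ-shift) {L} HτL = shiftZ≗⇒periodic (τ-injective (τ-shift L HτL))

  exactPeriod⇒∣n : ∀ {H k} .{{_ : NonZero k}} → ExactPeriod H k → k ∣ n
  exactPeriod⇒∣n {H} {k} (isPeriod , minimal) with n % k ≟ 0
  ... | yes n%k≡0 = m%n≡0⇒n∣m n k n%k≡0
  ... | no n%k≢0 = ⊥-elim (<⇒≱ (m%n<n n k) (minimal (n % k) remainderIsPeriod))
    where
      remainderIsPeriod : IsPeriod H (n % k)
      remainderIsPeriod = n≢0⇒n>0 n%k≢0 , m%n≤m n k , λ L HτL →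
        τ-cong (periodic⇒shiftZ≗ (periodic-% {S = L} (isPeriod⇒periodic {H} isPeriod {L} HτL)))

  τ-·-τ⊕ : ∀ (L J : SubsetZ n) → (τ L · τ (L ⊕ J)) ≈ τ J
  τ-·-τ⊕ L J y = trans (τ-· L (L ⊕ J) y)
    (τ-cong (λ x → trans (sym (xor-assoc (L x) (L x) (J x))) (cong (_xor J x) (xor-same (L x)))) y)

  module _ (B : Aut n → Set) (ε : Bool) where

    Gen-GenSet-exchange : ∀ {J L} → B (τ (L ⊕ J)) → ∀ {f} → Gen (GenSet B ε J) f → Gen (GenSet B ε L) f
    Gen-GenSet-exchange {J} {L} b = go
      where
        go : ∀ {f} → Gen (GenSet B ε J) f → Gen (GenSet B ε L) f
        go (gen (inj₁ bf)) = gen (inj₁ bf)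
        go (gen (inj₂ (inj₁ f≈ρτ))) = gen (inj₂ (inj₁ f≈ρτ))
        go (gen (inj₂ (inj₂ f≈στJ))) =
          ext (λ y → trans (τ-·-τ⊕ L J (τ₀^ ε (σ y))) (sym (f≈στJ y)))
              (mul (gen (inj₂ (inj₂ λ _ → refl))) (gen (inj₁ b)))
        go one = one
        go (mul gf gg) = mul (go gf) (go gg)
        go (ext f≈g gf) = ext f≈g (go gf)

    Gen-GenSet-≐ : (∀ {f g} → f ≈ g → B f → B g) → ∀ {J L} → B (τ (L ⊕ J)) →
                   Gen (GenSet B ε J) ≐ Gen (GenSet B ε L)
    Gen-GenSet-≐ B-resp {J} {L} b _ =
      Gen-GenSet-exchange {J} {L} b ,
      Gen-GenSet-exchange {L} {J} (B-resp (τ-cong (λ x → xor-comm (L x) (J x))) b)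

lemma3p3 : (n : ℕ) .{{_ : NonZero n}} (B : Aut n → Set) (ε : Bool) (J : SubsetZ n)
    (k : ℕ) .{{_ : NonZero k}} →
    (∀ f → B f → Σ (SubsetZ n) (λ L → f ≈ τ L)) →
    Σ (Aut n) (λ f → B f × ¬ (f ≈ idA)) →
    (∀ g b → Gen (GenSet B ε J) g → B b → Σ (Aut n) (λ b' → B b' × ((b · g) ≈ (g · b')))) →
    B (τfull^ ε) →
    B (τ J · τ (negZ J)) →
    B (τ J · τ (shiftZ J 1)) →
    ExactPeriod B k →
    B ≐ Gen (ClsGens k) →
    Σ (SubsetZ n) (λ L →
      ((τ L ≈ τ fullZ) ⊎ ((2 * k ∣ n) × (τ L ≈ prodCls2k k)))
      × (Gen (GenSet B ε J) ≐ Gen (GenSet B ε L)))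
lemma3p3 n B ε J k _ _ _ _ _ τJτJ+1∈B exact B≐ =
  [ (λ J-periodic →
       fullZ , inj₁ (λ _ → refl) ,
       exchange {fullZ} (periodic⇒B (⊕-periodic {S = fullZ} {J} (λ _ → refl) J-periodic)))
  , (λ J-antiperiodic → let 2k∣n = antiperiodic⇒2*∣n {S = J} k∣n J-antiperiodic in
       halfClass k , inj₂ (2k∣n , λ y → sym (prodCls2k≈τ-halfClass k 2k∣n y)) ,
       exchange {halfClass k} (periodic⇒B
         (⊕-antiperiodic {S = halfClass k} {J} (halfClass-antiperiodic k 2k∣n) J-antiperiodic)))
  ]′ (periodic-or-antiperiodic {S = J} (B⇒periodic (B-resp (τ-· J (shiftZ J 1)) τJτJ+1∈B)))
  where
    k∣n : k ∣ n
    k∣n = exactPeriod⇒∣n {H = B} exact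
    B-resp : ∀ {f g} → f ≈ g → B f → B g
    B-resp f≈g Bf = proj₂ (B≐ _) (ext f≈g (proj₁ (B≐ _) Bf))
    B⇒periodic : ∀ {S : SubsetZ n} → B (τ S) → Periodic S k
    B⇒periodic {S} = isPeriod⇒periodic {H = B} (proj₁ exact) {S}
    periodic⇒B : ∀ {S : SubsetZ n} → Periodic S k → B (τ S)
    periodic⇒B p = proj₂ (B≐ _) (periodic⇒Gen-ClsGens k k∣n p)
    exchange : ∀ {L : SubsetZ n} → B (τ (L ⊕ J)) → Gen (GenSet B ε J) ≐ Gen (GenSet B ε L)
    exchange {L} = Gen-GenSet-≐ B ε B-resp {J} {L}
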